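{- Let $\mathcal A$ be any one of the four second-order cellular automata $\mathcal R_1,\mathcal R_2,\mathcal R_3,\mathcal R_3'$ defined in the context, started from the initial configuration $C_0$ in which cell $(0,0)$ has state $(1,0)$ and every other cell has state $(0,0)$. Then for every $n\ge 0$ no cell of $C_n$ has state $(1,1)$ (i.e. $R_3(n)=0$). Moreover, the sequences $R(n)$, $R_1(n)$, $R_2(n)$ ($n\ge 0$) are the same for all four automata $\mathcal R_1,\mathcal R_2,\mathcal R_3,\mathcal R_3'$.
   Context: Cells are indexed by $(i,j)\in\mathbb Z^2$. For a binary configuration $c=(c_{i,j})$ put $\Sigma^\times c_{i,j}=c_{i-1,j-1}+c_{i-1,j+1}+c_{i+1,j-1}+c_{i+1,j+1}$ and $\Sigma^+ c_{i,j}=c_{i,j-1}+c_{i,j+1}+c_{i+1,j}+c_{i-1,j}$ (ordinary integer sums). Four two-state rules $c\mapsto f[c]$ are: $\mathcal C_1$: $c_{i,j}\mapsto \Sigma^\times c_{i,j}\bmod 2$; $\mathcal C_2$: $c_{i,j}\mapsto \Sigma^+ c_{i,j}\bmod 2$; $\mathcal C_3$: $c_{i,j}\mapsto 1$ if $\Sigma^+c_{i,j}=1$ and $0$ otherwise; $\mathcal C_3'$: $c_{i,j}\mapsto 1$ if $\Sigma^+c_{i,j}=1$ and $\Sigma^\times c_{i,j}=0$, and $0$ otherwise. The second-order automaton $\mathcal R_1,\mathcal R_2,\mathcal R_3,\mathcal R_3'$ derived from $\mathcal C_1,\mathcal C_2,\mathcal C_3,\mathcal C_3'$ respectively has at each cell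 a pair of bits $(c,c')$ and updates all cells simultaneously by $(c,c')\mapsto (f[c]+c' \bmod 2,\ c)$, where $f[c]$ is the value of the two-state rule computed from the first components of the neighbouring cells. The value of a cell with state $(c,c')$ is $c+2c'\in\{0,1,2,3\}$. $C_n$ denotes the configuration after $n$ steps from $C_0$; $R(n)$ is the number of cells of $C_n$ with nonzero value and $R_k(n)$ ($k=1,2,3$) the number with value $k$. -}

module Defs where

open import Data.Bool using (Bool; true; false; _∧_; _xor_; if_then_else_)
open import Data.Nat using (ℕ; zero; suc; _+_; _*_; _%_; _≡ᵇ_)
open import Data.Integer using (ℤ; +_; _-_; 0ℤ; 1ℤ)
import Data.Integer as ℤ
open import Data.List using (List; map; upTo; concatMap)
open import Data.Nat.ListAction using (sum)
open import Data.Product using (_×_; _,_; proj₁; proj₂)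

Config : Set
Config = ℤ → ℤ → Bool

bit : Bool → ℕ
bit true  = 1
bit false = 0

sumX : Config → ℤ → ℤ → ℕ
sumX c i j = bit (c (i - 1ℤ) (j - 1ℤ)) + bit (c (i - 1ℤ) (j ℤ.+ 1ℤ))
           + bit (c (i ℤ.+ 1ℤ) (j - 1ℤ)) + bit (c (i ℤ.+ 1ℤ) (j ℤ.+ 1ℤ))

sumP : Config → ℤ → ℤ → ℕ
sumP c i j = bit (c i (j - 1ℤ)) + bit (c i (j ℤ.+ 1ℤ))
           + bit (c (i ℤ.+ 1ℤ) j) + bit (c (i - 1ℤ) j)

data Rule : Set where
  C1 C2 C3 C3' : Rule

apply : Rule → Config → ℤ → ℤ → Bool
apply C1  c i j = (sumX c i j % 2) ≡ᵇ 1
apply C2  c i j = (sumP c i j % 2) ≡ᵇ 1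
apply C3  c i j = sumP c i j ≡ᵇ 1
apply C3' c i j = (sumP c i j ≡ᵇ 1) ∧ (sumX c i j ≡ᵇ 0)

Config2 : Set
Config2 = ℤ → ℤ → Bool × Bool

firsts : Config2 → Config
firsts s i j = proj₁ (s i j)

step : Rule → Config2 → Config2
step r s i j = (apply r (firsts s) i j xor proj₂ (s i j)) , proj₁ (s i j)

isZero : ℤ → Bool
isZero (+ zero) = true
isZero _        = false

C0 : Config2
C0 i j = (isZero i ∧ isZero j) , false

conf : Rule → ℕ → Config2
conf r zero    = C0
conf r (suc n) = step r (conf r n)

value : Bool × Bool → ℕ
value (c , c') = bit c + 2 * bit c'

range : ℕ → List ℤ
range N = map (λ k → + k - + N) (upTo (suc (N + N)))

countBox : ℕ → (Bool × Bool → Bool) → Config2 → ℕ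
countBox N P s =
  sum (concatMap (λ i → map (λ j → bit (P (s i j))) (range N)) (range N))

nonzeroV : Bool × Bool → Bool
nonzeroV x = if value x ≡ᵇ 0 then false else true

valueIs : ℕ → Bool × Bool → Bool
valueIs k x = value x ≡ᵇ k

-- R(n), R_k(n) computed over the box [-N,N]² (N ≥ n contains the support of C_n)
Rbox : ℕ → Rule → ℕ → ℕ
Rbox N r n = countBox N nonzeroV (conf r n)

Rkbox : ℕ → ℕ → Rule → ℕ → ℕ
Rkbox k N r n = countBox N (valueIs k) (conf r n)

module Submission where

-- R1 is linear over GF(2): with c n the first layer of C_n, c (n+1) = X (c n) ⊕ c (n-1),
-- where X is the xor of the four diagonal neighbours.  From this:
--  * the two layers of R1 live on the disjoint sublattices p ≡ q ≡ n and p ≡ q ≡ n+1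
--    (mod 2), so R1 never shows the state (1,1)  (c-lattice, R1-no-11);
--  * R1 is self-similar under doubling (the laws EvenLaw/OddLaw, i.e. squaring in
--    GF(2)[x,y]), and strong induction along these laws shows that no cell of R1 ever
--    has exactly three live diagonal neighbours  (doubling, no-three);
--  * R2 is R1 read in the rotated coordinates (i + j , i - j)  (rotation);
--  * on the orbit of R2 the orthogonal count is never 3, so rule C3 ("= 1") agrees with
--    C2 ("odd"); and a cell of R2 never has live orthogonal and live diagonal neighbours
--    at once, so C3' agrees with C3: R3 and R3' have the same orbit as R2  (same-orbit).
-- For the cell counts, C_n vanishes outside [-n , n]² (light-cone), and the rotation is
-- a bijection between the counted cells of R2 and of R1 in any box [-N , N]² with n ≤ N,
-- because the non-empty cells of R1 have coordinates of equal parity (countBox-rotation).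

open import Defs
open import Data.Bool using (Bool; true; false; not; _xor_; _∧_; T)
open import Data.Bool.Properties
  using (not-involutive; not-injective; not-¬; ¬-not; xor-identityʳ; ∧-identityʳ; ∧-zeroʳ; ∧-conicalˡ; ∧-conicalʳ; ⇔→≡)
open import Data.Bool.Solver using (module xor-∧-Solver)
open import Data.Nat using (ℕ; zero; suc; _≤_; _<_; z≤n; s≤s)
import Data.Nat as ℕ
import Data.Bool as Bool
import Data.Nat.Properties as ℕP
open import Data.Integer using (ℤ; +_; -[1+_]; _+_; _-_; -_; _*_; 0ℤ; 1ℤ; ∣_∣)
import Data.Integer.Properties as ℤP
open import Data.Integer.Tactic.RingSolver using (solve-∀)
open import Data.Nat.Tactic.RingSolver using () renaming (solve-∀ to ℕ-solve-∀)
open import Function.Base using (_∘_)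
open import Function.Bundles using (_⇔_; mk⇔)
open import Data.List using (List; []; _∷_; map; _++_; length; filterᵇ; cartesianProduct; concatMap)
open import Data.List.Properties using (map-∘; map-++; map-cong; concatMap-cong; length-map)
open import Data.Nat.ListAction using (sum)
open import Data.List.Membership.Propositional using (_∈_)
open import Data.List.Membership.Propositional.Properties
  using (∈-map⁺; ∈-map⁻; ∈-upTo⁺; ∈-filter⁺; ∈-filter⁻; ∈-cartesianProduct⁺)
open import Data.List.Relation.Unary.Unique.Propositional using (Unique)
import Data.List.Relation.Unary.Unique.Propositional.Properties as Unique
open import Data.List.Membership.Propositional.Properties.WithK using (unique∧set⇒bag)
open import Data.List.Relation.Binary.BagAndSetEquality using (∼bag⇒↭)
open import Data.List.Relation.Binary.Permutation.Propositional.Properties using (↭-length)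
open import Data.Product using (_×_; _,_; proj₁; proj₂; ∃-syntax; uncurry)
open import Data.Sum using (_⊎_; inj₁; inj₂; [_,_]′)
import Data.Sum as Sum
open import Data.Empty using (⊥-elim)
open import Relation.Nullary using (yes; no)
open import Relation.Nullary.Decidable using (T?)
open import Data.Nat.Induction using (<-rec)
open import Relation.Binary.PropositionalEquality
  using (_≡_; _≢_; refl; sym; trans; cong; cong₂; subst; module ≡-Reasoning)
open ≡-Reasoning

count4 : Bool → Bool → Bool → Bool → ℕ
count4 w x y z = bit w ℕ.+ bit x ℕ.+ bit y ℕ.+ bit z

cong₄ : ∀ {A : Set} (g : Bool → Bool → Bool → Bool → A) {w w′ x x′ y y′ z z′} →
        w ≡ w′ → x ≡ x′ → y ≡ y′ → z ≡ z′ → g w x y z ≡ g w′ x′ y′ z′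
cong₄ g refl refl refl refl = refl

-- The parity of the count is the xor of the bits: this makes R1 and R2 linear over GF(2).
count4-odd : ∀ w x y z → ((count4 w x y z ℕ.% 2) ℕ.≡ᵇ 1) ≡ w xor x xor y xor z
count4-odd false false false false = refl
count4-odd false false false true  = refl
count4-odd false false true  false = refl
count4-odd false false true  true  = refl
count4-odd false true  false false = refl
count4-odd false true  false true  = refl
count4-odd false true  true  false = refl
count4-odd false true  true  true  = refl
count4-odd true  false false false = refl
count4-odd true  false false true  = refl
count4-odd true  false true  false = refl
count4-odd true  false true  true  = refl
count4-odd true  true  false false = refl
count4-odd true  true  false true  = refl
count4-odd true  true  true  false = refl
count4-odd true  true  true  true  = refl

count4-≤4 : ∀ w x y z → count4 w x y z ≤ 4
count4-≤4 w x y z =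
  ℕP.+-mono-≤ (ℕP.+-mono-≤ (ℕP.+-mono-≤ (bit≤1 w) (bit≤1 x)) (bit≤1 y)) (bit≤1 z)
  where
  bit≤1 : ∀ b → bit b ≤ 1
  bit≤1 false = z≤n
  bit≤1 true  = s≤s z≤n

one-iff-odd : ∀ {n} → n ≤ 4 → n ≢ 3 → (n ℕ.≡ᵇ 1) ≡ ((n ℕ.% 2) ℕ.≡ᵇ 1)
one-iff-odd {0} _ _ = refl
one-iff-odd {1} _ _ = refl
one-iff-odd {2} _ _ = refl
one-iff-odd {3} _ n≢3 = ⊥-elim (n≢3 refl)
one-iff-odd {4} _ _ = refl
one-iff-odd {suc (suc (suc (suc (suc _))))} (s≤s (s≤s (s≤s (s≤s ())))) _

-- A 2×2 block (listed row by row) with a dead diagonal has at most two live cells.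
count4-antidiagonal-dead : ∀ w z → count4 w false false z ≢ 3
count4-antidiagonal-dead false false ()
count4-antidiagonal-dead false true  ()
count4-antidiagonal-dead true  false ()
count4-antidiagonal-dead true  true  ()

count4-diagonal-dead : ∀ x y → count4 false x y false ≢ 3
count4-diagonal-dead false false ()
count4-diagonal-dead false true  ()
count4-diagonal-dead true  false ()
count4-diagonal-dead true  true  ()

parℕ : ℕ → Bool
parℕ zero    = false
parℕ (suc n) = not (parℕ n)

par : ℤ → Bool
par (+ n)      = parℕ n
par -[1+ n ]   = not (parℕ n)

par-+1 : ∀ i → par (i + 1ℤ) ≡ not (par i)
par-+1 (+ n)          = cong parℕ (ℕP.+-comm n 1)
par-+1 -[1+ zero ]    = refl
par-+1 -[1+ suc n ]   = sym (not-involutive _)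

par--1 : ∀ i → par (i - 1ℤ) ≡ not (par i)
par--1 (+ zero)    = refl
par--1 (+ suc n)   = sym (not-involutive _)
par--1 -[1+ n ]    = cong (λ k → not (parℕ (suc k))) (ℕP.+-identityʳ n)

parℕ-double : ∀ m → parℕ (m ℕ.+ m) ≡ false
parℕ-double zero    = refl
parℕ-double (suc m) = begin
  parℕ (suc (m ℕ.+ suc m))   ≡⟨ cong (λ k → parℕ (suc k)) (ℕP.+-suc m m) ⟩
  not (not (parℕ (m ℕ.+ m))) ≡⟨ not-involutive _ ⟩
  parℕ (m ℕ.+ m)             ≡⟨ parℕ-double m ⟩
  false                      ∎

dbl : ℤ → ℤ
dbl k = k + k

pos-suc : ∀ n → + suc n ≡ + n + 1ℤ
pos-suc n = cong +_ (ℕP.+-comm 1 n)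

neg-suc : ∀ n → -[1+ suc n ] ≡ -[1+ n ] - 1ℤ
neg-suc n = cong (λ k → -[1+ suc k ]) (sym (ℕP.+-identityʳ n))

odd+1 : ∀ k → (k + k) + 1ℤ + 1ℤ ≡ (k + 1ℤ) + (k + 1ℤ)
odd+1 = solve-∀

odd-1 : ∀ k → (k + k) + 1ℤ - 1ℤ ≡ k + k
odd-1 = solve-∀

even-1 : ∀ k → (k + k) - 1ℤ ≡ (k - 1ℤ) + (k - 1ℤ) + 1ℤ
even-1 = solve-∀

halve : ∀ i → ∃[ k ] (i ≡ dbl k × par i ≡ false ⊎ i ≡ dbl k + 1ℤ × par i ≡ true)
halve (+ zero) = 0ℤ , inj₁ (refl , refl)
halve (+ suc n) with halve (+ n)
... | k , inj₁ (i≡ , p) = k , inj₂ (trans (pos-suc n) (cong (_+ 1ℤ) i≡) , cong not p)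
... | k , inj₂ (i≡ , p) = k + 1ℤ , inj₁ (trans (pos-suc n) (trans (cong (_+ 1ℤ) i≡) (odd+1 k)) , cong not p)
halve -[1+ zero ] = -[1+ zero ] , inj₂ (refl , refl)
halve -[1+ suc n ] with halve -[1+ n ]
... | k , inj₁ (i≡ , p) = k - 1ℤ , inj₂ (trans (neg-suc n) (trans (cong (_- 1ℤ) i≡) (even-1 k)) , cong not p)
... | k , inj₂ (i≡ , p) = k , inj₁ (trans (neg-suc n) (trans (cong (_- 1ℤ) i≡) (odd-1 k)) , cong not p)

xor4 : Bool → Bool → Bool → Bool → Bool
xor4 w x y z = w xor x xor y xor z

diag : {A : Set} → (Bool → Bool → Bool → Bool → A) → Config → ℤ → ℤ → A
diag g f i j = g (f (i - 1ℤ) (j - 1ℤ)) (f (i - 1ℤ) (j + 1ℤ)) (f (i + 1ℤ) (j - 1ℤ)) (f (i + 1ℤ) (j + 1ℤ))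

-- The automaton R1 lives on two sublattices

-- The two layers of R1: c n is the first component of C_n and c' n the second,
-- which by definition of the second-order step is c (n - 1) (empty for n = 0).
c : ℕ → Config
c n = firsts (conf C1 n)

c' : ℕ → Config
c' n i j = proj₂ (conf C1 n i j)

X : Config → ℤ → ℤ → Bool
X = diag xor4

c-suc : ∀ n i j → c (suc n) i j ≡ X (c n) i j xor c' n i j
c-suc n i j = cong (_xor c' n i j)
  (count4-odd (c n (i - 1ℤ) (j - 1ℤ)) (c n (i - 1ℤ) (j + 1ℤ)) (c n (i + 1ℤ) (j - 1ℤ)) (c n (i + 1ℤ) (j + 1ℤ)))

xor-true : ∀ a b → a xor b ≡ true → a ≡ true ⊎ b ≡ true
xor-true true  _ _ = inj₁ refl
xor-true false _ h = inj₂ h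

X-true : ∀ f i j → X f i j ≡ true →
         f (i - 1ℤ) (j - 1ℤ) ≡ true ⊎ f (i - 1ℤ) (j + 1ℤ) ≡ true
         ⊎ f (i + 1ℤ) (j - 1ℤ) ≡ true ⊎ f (i + 1ℤ) (j + 1ℤ) ≡ true
X-true f i j h with f (i - 1ℤ) (j - 1ℤ) | f (i - 1ℤ) (j + 1ℤ) | f (i + 1ℤ) (j - 1ℤ)
... | true  | _     | _     = inj₁ refl
... | false | true  | _     = inj₂ (inj₁ refl)
... | false | false | true  = inj₂ (inj₂ (inj₁ refl))
... | false | false | false = inj₂ (inj₂ (inj₂ h))

par-from-pred : ∀ {i b} → par (i - 1ℤ) ≡ b → par i ≡ not b
par-from-pred {i} h = trans (sym (not-involutive (par i))) (cong not (trans (sym (par--1 i)) h))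

par-from-succ : ∀ {i b} → par (i + 1ℤ) ≡ b → par i ≡ not b
par-from-succ {i} h = trans (sym (not-involutive (par i))) (cong not (trans (sym (par-+1 i)) h))

c-lattice  : ∀ n p q → c n p q ≡ true → par p ≡ parℕ n × par q ≡ parℕ n
c'-lattice : ∀ n p q → c' n p q ≡ true → par p ≡ not (parℕ n) × par q ≡ not (parℕ n)

c-lattice zero (+ zero) (+ zero) _ = refl , refl
c-lattice zero (+ zero) (+ suc _) ()
c-lattice zero (+ zero) -[1+ _ ] ()
c-lattice zero (+ suc _) _ ()
c-lattice zero -[1+ _ ] _ ()
c-lattice (suc n) p q h with xor-true _ _ (trans (sym (c-suc n p q)) h)
... | inj₂ h' = c'-lattice n p q h'
... | inj₁ h' with X-true (c n) p q h'
...   | inj₁ e                = let (a , b) = c-lattice n _ _ e in par-from-pred {p} a , par-from-pred {q} b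
...   | inj₂ (inj₁ e)         = let (a , b) = c-lattice n _ _ e in par-from-pred {p} a , par-from-succ {q} b
...   | inj₂ (inj₂ (inj₁ e))  = let (a , b) = c-lattice n _ _ e in par-from-succ {p} a , par-from-pred {q} b
...   | inj₂ (inj₂ (inj₂ e))  = let (a , b) = c-lattice n _ _ e in par-from-succ {p} a , par-from-succ {q} b

c'-lattice zero _ _ ()
c'-lattice (suc n) p q h = let (a , b) = c-lattice n p q h in
  trans a (sym (not-involutive _)) , trans b (sym (not-involutive _))

c-off-lattice : ∀ n p q → par p ≡ not (parℕ n) ⊎ par q ≡ not (parℕ n) → c n p q ≡ false
c-off-lattice n p q off = ¬-not live⇒on
  where
  live⇒on : c n p q ≢ true
  live⇒on h with c-lattice n p q h
  ... | a , b = [ not-¬ a , not-¬ b ]′ off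

-- No cell of R1 is in state (1,1): the two layers live on disjoint sublattices.
R1-no-11 : ∀ n p q → conf C1 n p q ≢ (true , true)
R1-no-11 n p q h = not-¬ (proj₁ (c-lattice n p q (cong proj₁ h))) (proj₁ (c'-lattice n p q (cong proj₂ h)))

R1-checkerboard : ∀ n p q → c n p q ≡ true ⊎ c' n p q ≡ true → par p ≡ par q
R1-checkerboard n p q (inj₁ h) = let (a , b) = c-lattice n p q h in trans a (sym b)
R1-checkerboard n p q (inj₂ h) = let (a , b) = c'-lattice n p q h in trans a (sym b)

block : {A : Set} → (Bool → Bool → Bool → Bool → A) → Config → ℤ → ℤ → A
block g f p q = g (f p q) (f p (q + 1ℤ)) (f (p + 1ℤ) q) (f (p + 1ℤ) (q + 1ℤ))

window : {A : Set} → (Bool → Bool → Bool → Bool → A) → Config → ℤ → ℤ → A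
window g f p q = g (block xor4 f (p - 1ℤ) (q - 1ℤ)) (block xor4 f (p - 1ℤ) q)
                   (block xor4 f p (q - 1ℤ)) (block xor4 f p q)

window9 : {A : Set} → (Bool → Bool → Bool → Bool → A) →
          Bool → Bool → Bool → Bool → Bool → Bool → Bool → Bool → Bool → A
window9 g mm m0 mp zm zz zp pm p0 pp =
  g (xor4 mm m0 zm zz) (xor4 m0 mp zz zp) (xor4 zm zz pm p0) (xor4 zz zp p0 pp)

pred-succ : ∀ p → p - 1ℤ + 1ℤ ≡ p
pred-succ = solve-∀

window-cells : ∀ {A : Set} (g : Bool → Bool → Bool → Bool → A) f p q →
  window g f p q ≡ window9 g (f (p - 1ℤ) (q - 1ℤ)) (f (p - 1ℤ) q) (f (p - 1ℤ) (q + 1ℤ))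
                             (f p (q - 1ℤ)) (f p q) (f p (q + 1ℤ))
                             (f (p + 1ℤ) (q - 1ℤ)) (f (p + 1ℤ) q) (f (p + 1ℤ) (q + 1ℤ))
window-cells g f p q rewrite pred-succ p | pred-succ q = refl

-- Each cell of the window except the corners lies in an even number of its blocks.
window9-xor : ∀ mm m0 mp zm zz zp pm p0 pp →
  window9 xor4 mm m0 mp zm zz zp pm p0 pp ≡ xor4 mm mp pm pp
window9-xor = solve 9 (λ mm m0 mp zm zz zp pm p0 pp →
  (mm :+ (m0 :+ (zm :+ zz))) :+ ((m0 :+ (mp :+ (zz :+ zp)))
    :+ ((zm :+ (zz :+ (pm :+ p0))) :+ (zz :+ (zp :+ (p0 :+ pp)))))
  := mm :+ (mp :+ (pm :+ pp))) refl
  where open xor-∧-Solver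

window-xor : ∀ f p q → window xor4 f p q ≡ X f p q
window-xor f p q = trans (window-cells xor4 f p q)
  (window9-xor (f (p - 1ℤ) (q - 1ℤ)) (f (p - 1ℤ) q) (f (p - 1ℤ) (q + 1ℤ))
               (f p (q - 1ℤ)) (f p q) (f p (q + 1ℤ))
               (f (p + 1ℤ) (q - 1ℤ)) (f (p + 1ℤ) q) (f (p + 1ℤ) (q + 1ℤ)))

-- Self-similarity of R1 under doubling

csum : ℕ → Config
csum m p q = c m p q xor c' m p q

-- Doubling laws (the Frobenius map of GF(2)[x,y] in disguise): at time 2m the first
-- layer on the even sublattice is the sum of both layers at time m, and at time 2m+1
-- on the odd sublattice it is the blockwise xor of c m.
EvenLaw : ℕ → Set
EvenLaw m = ∀ p q → c (m ℕ.+ m) (dbl p) (dbl q) ≡ csum m p q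

OddLaw : ℕ → Set
OddLaw m = ∀ p q → c (suc (m ℕ.+ m)) (dbl p + 1ℤ) (dbl q + 1ℤ) ≡ block xor4 (c m) p q

diag-at-odd : ∀ m → EvenLaw m → ∀ {A : Set} (g : Bool → Bool → Bool → Bool → A) p q →
  diag g (c (m ℕ.+ m)) (dbl p + 1ℤ) (dbl q + 1ℤ) ≡ block g (csum m) p q
diag-at-odd m even g p q =
  cong₄ g (at (odd-1 p) (odd-1 q)) (at (odd-1 p) (odd+1 q)) (at (odd+1 p) (odd-1 q)) (at (odd+1 p) (odd+1 q))
  where
  at : ∀ {i j a b} → i ≡ dbl a → j ≡ dbl b → c (m ℕ.+ m) i j ≡ csum m a b
  at {a = a} {b} i≡ j≡ = trans (cong₂ (c (m ℕ.+ m)) i≡ j≡) (even a b)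

diag-at-even : ∀ m → OddLaw m → ∀ {A : Set} (g : Bool → Bool → Bool → Bool → A) p q →
  diag g (c (suc (m ℕ.+ m))) (dbl p) (dbl q) ≡ window g (c m) p q
diag-at-even m odd g p q =
  cong₄ g (at (even-1 p) (even-1 q)) (at (even-1 p) refl) (at refl (even-1 q)) (odd p q)
  where
  at : ∀ {i j a b} → i ≡ dbl a + 1ℤ → j ≡ dbl b + 1ℤ → c (suc (m ℕ.+ m)) i j ≡ block xor4 (c m) a b
  at {a = a} {b} i≡ j≡ = trans (cong₂ (c (suc (m ℕ.+ m))) i≡ j≡) (odd a b)

block-csum : ∀ m p q → block xor4 (csum m) p q xor block xor4 (c' m) p q ≡ block xor4 (c m) p q
block-csum m p q = identity (c m p q) (c m p (q + 1ℤ)) (c m (p + 1ℤ) q) (c m (p + 1ℤ) (q + 1ℤ))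
                            (c' m p q) (c' m p (q + 1ℤ)) (c' m (p + 1ℤ) q) (c' m (p + 1ℤ) (q + 1ℤ))
  where
  open xor-∧-Solver
  identity : ∀ a b d e a' b' d' e' →
    xor4 (a xor a') (b xor b') (d xor d') (e xor e') xor xor4 a' b' d' e' ≡ xor4 a b d e
  identity = solve 8 (λ a b d e a' b' d' e' →
    ((a :+ a') :+ ((b :+ b') :+ ((d :+ d') :+ (e :+ e')))) :+ (a' :+ (b' :+ (d' :+ e')))
    := a :+ (b :+ (d :+ e))) refl

-- The odd law at m follows from the even law at m together with its analogue for c'
-- (which is the odd law at m - 1).
odd-law : ∀ m → EvenLaw m →
  (∀ p q → c' (m ℕ.+ m) (dbl p + 1ℤ) (dbl q + 1ℤ) ≡ block xor4 (c' m) p q) → OddLaw m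
odd-law m even odd' p q = begin
  c (suc (m ℕ.+ m)) P Q                              ≡⟨ c-suc (m ℕ.+ m) P Q ⟩
  X (c (m ℕ.+ m)) P Q xor c' (m ℕ.+ m) P Q           ≡⟨ cong₂ _xor_ (diag-at-odd m even xor4 p q) (odd' p q) ⟩
  block xor4 (csum m) p q xor block xor4 (c' m) p q  ≡⟨ block-csum m p q ⟩
  block xor4 (c m) p q                               ∎
  where
  P = dbl p + 1ℤ
  Q = dbl q + 1ℤ

xor-swap : ∀ a b d → a xor (b xor d) ≡ (a xor d) xor b
xor-swap = solve 3 (λ a b d → a :+ (b :+ d) := (a :+ d) :+ b) refl
  where open xor-∧-Solver

even-law-suc : ∀ m → EvenLaw m → OddLaw m → EvenLaw (suc m)
even-law-suc m even odd p q = begin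
  c (suc m ℕ.+ suc m) (dbl p) (dbl q)
    ≡⟨ cong (λ n → c (suc n) (dbl p) (dbl q)) (ℕP.+-suc m m) ⟩
  c (suc (suc (m ℕ.+ m))) (dbl p) (dbl q)
    ≡⟨ c-suc (suc (m ℕ.+ m)) (dbl p) (dbl q) ⟩
  X (c (suc (m ℕ.+ m))) (dbl p) (dbl q) xor c (m ℕ.+ m) (dbl p) (dbl q)
    ≡⟨ cong₂ _xor_ corners (even p q) ⟩
  X (c m) p q xor (c m p q xor c' m p q)
    ≡⟨ xor-swap (X (c m) p q) (c m p q) (c' m p q) ⟩
  (X (c m) p q xor c' m p q) xor c m p q
    ≡⟨ cong (_xor c m p q) (sym (c-suc m p q)) ⟩
  csum (suc m) p q ∎
  where
  corners : X (c (suc (m ℕ.+ m))) (dbl p) (dbl q) ≡ X (c m) p q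
  corners = trans (diag-at-even m odd xor4 p q) (window-xor (c m) p q)

isZero-dbl : ∀ p → isZero (dbl p) ≡ isZero p
isZero-dbl (+ zero)  = refl
isZero-dbl (+ suc n) = refl
isZero-dbl -[1+ n ]  = refl

even-law-zero : EvenLaw zero
even-law-zero p q =
  trans (cong₂ _∧_ (isZero-dbl p) (isZero-dbl q)) (sym (xor-identityʳ _))

doubling : ∀ m → EvenLaw m × OddLaw m
doubling zero = even-law-zero , odd-law zero even-law-zero (λ p q → refl)
doubling (suc m) =
  let (even , odd) = doubling m
      even′ = even-law-suc m even odd
      -- c' at time 2m + 2 is c at time 2m + 1
      odd′ = λ p q → trans (cong (λ n → c n (dbl p + 1ℤ) (dbl q + 1ℤ)) (ℕP.+-suc m m)) (odd p q)
  in even′ , odd-law (suc m) even′ odd′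

-- No cell of R1 sees exactly three live diagonal neighbours

NoThree : ℕ → Set
NoThree n = ∀ i j → sumX (c n) i j ≢ 3

zero-not-three : ∀ {k} → k ≡ 0 → k ≢ 3
zero-not-three refl ()

par-pred-flip : ∀ i {b} → par i ≡ b → par (i - 1ℤ) ≡ not b
par-pred-flip i h = trans (par--1 i) (cong not h)

par-succ-flip : ∀ i {b} → par i ≡ b → par (i + 1ℤ) ≡ not b
par-succ-flip i h = trans (par-+1 i) (cong not h)

-- A cell with a coordinate of the parity of n has all its diagonal neighbours off the
-- sublattice of c n.
sumX-off-lattice : ∀ n i j → par i ≡ parℕ n ⊎ par j ≡ parℕ n → sumX (c n) i j ≡ 0
sumX-off-lattice n i j (inj₁ pi) =
  cong₄ count4 (row (i - 1ℤ) (j - 1ℤ) (par-pred-flip i pi)) (row (i - 1ℤ) (j + 1ℤ) (par-pred-flip i pi))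
               (row (i + 1ℤ) (j - 1ℤ) (par-succ-flip i pi)) (row (i + 1ℤ) (j + 1ℤ) (par-succ-flip i pi))
  where
  row : ∀ x y → par x ≡ not (parℕ n) → c n x y ≡ false
  row x y h = c-off-lattice n x y (inj₁ h)
sumX-off-lattice n i j (inj₂ pj) =
  cong₄ count4 (col (i - 1ℤ) (j - 1ℤ) (par-pred-flip j pj)) (col (i - 1ℤ) (j + 1ℤ) (par-succ-flip j pj))
               (col (i + 1ℤ) (j - 1ℤ) (par-pred-flip j pj)) (col (i + 1ℤ) (j + 1ℤ) (par-succ-flip j pj))
  where
  col : ∀ x y → par y ≡ not (parℕ n) → c n x y ≡ false
  col x y h = c-off-lattice n x y (inj₂ h)

Checkerboard : Config → Set
Checkerboard f = ∀ p q → f p q ≡ true → par p ≡ par q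

checkerboard-dead : ∀ {f} → Checkerboard f → ∀ p q → par p ≢ par q → f p q ≡ false
checkerboard-dead lattice p q neq = ¬-not (λ h → neq (lattice p q h))

-- In a checkerboard configuration every 2×2 block has a dead diagonal, hence never
-- three live cells.
checkerboard-block : ∀ f → Checkerboard f → ∀ a b → block count4 f a b ≢ 3
checkerboard-block f lattice a b with par a Bool.≟ par b
... | yes same = λ e → count4-antidiagonal-dead (f a b) (f (a + 1ℤ) (b + 1ℤ))
      (trans (cong₄ count4 (refl {x = f a b}) (sym (dead a (b + 1ℤ) mixed₁))
                          (sym (dead (a + 1ℤ) b mixed₂)) (refl {x = f (a + 1ℤ) (b + 1ℤ)})) e)
  where
  dead = checkerboard-dead lattice
  mixed₁ : par a ≢ par (b + 1ℤ)
  mixed₁ e = not-¬ same (trans e (par-+1 b))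
  mixed₂ : par (a + 1ℤ) ≢ par b
  mixed₂ e = not-¬ (sym same) (trans (sym e) (par-+1 a))
... | no differ = λ e → count4-diagonal-dead (f a (b + 1ℤ)) (f (a + 1ℤ) b)
      (trans (cong₄ count4 (sym (dead a b differ)) refl refl (sym (dead (a + 1ℤ) (b + 1ℤ) mixed))) e)
  where
  dead = checkerboard-dead lattice
  mixed : par (a + 1ℤ) ≢ par (b + 1ℤ)
  mixed e = differ (not-injective (trans (sym (par-+1 a)) (trans e (par-+1 b))))

csum-checkerboard : ∀ m → Checkerboard (csum m)
csum-checkerboard m p q h = R1-checkerboard m p q (xor-true _ _ h)

-- At even time 2m an odd cell sees a 2×2 block of csum m: never three live cells.
no-three-even : ∀ m a b → sumX (c (m ℕ.+ m)) (dbl a + 1ℤ) (dbl b + 1ℤ) ≢ 3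
no-three-even m a b e =
  checkerboard-block (csum m) (csum-checkerboard m) a b
    (trans (sym (diag-at-odd m (proj₁ (doubling m)) count4 a b)) e)

window-rows-dead : ∀ f a b → (∀ y → f (a - 1ℤ) y ≡ false) → (∀ y → f (a + 1ℤ) y ≡ false) →
                   window count4 f a b ≢ 3
window-rows-dead f a b dead₋ dead₊
  rewrite window-cells count4 f a b
        | dead₋ (b - 1ℤ) | dead₋ b | dead₋ (b + 1ℤ) | dead₊ (b - 1ℤ) | dead₊ b | dead₊ (b + 1ℤ)
  = middle-row (f a (b - 1ℤ)) (f a b) (f a (b + 1ℤ))
  where
  middle-row : ∀ zm zz zp → window9 count4 false false false zm zz zp false false false ≢ 3
  middle-row false false false ()
  middle-row false false true  ()
  middle-row false true  false ()
  middle-row false true  true  ()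
  middle-row true  false false ()
  middle-row true  false true  ()
  middle-row true  true  false ()
  middle-row true  true  true  ()

window-cols-dead : ∀ f a b → (∀ x → f x (b - 1ℤ) ≡ false) → (∀ x → f x (b + 1ℤ) ≡ false) →
                   window count4 f a b ≢ 3
window-cols-dead f a b dead₋ dead₊
  rewrite window-cells count4 f a b
        | dead₋ (a - 1ℤ) | dead₋ a | dead₋ (a + 1ℤ) | dead₊ (a - 1ℤ) | dead₊ a | dead₊ (a + 1ℤ)
  = middle-col (f (a - 1ℤ) b) (f a b) (f (a + 1ℤ) b)
  where
  middle-col : ∀ m0 zz p0 → window9 count4 false m0 false false zz false false p0 false ≢ 3
  middle-col false false false ()
  middle-col false false true  ()
  middle-col false true  false ()
  middle-col false true  true  ()
  middle-col true  false false ()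
  middle-col true  false true  ()
  middle-col true  true  false ()
  middle-col true  true  true  ()

-- If the middle row and column are dead, each block contains exactly one corner.
window-cross-dead : ∀ f a b → (∀ y → f a y ≡ false) → (∀ x → f x b ≡ false) →
                    window count4 f a b ≡ diag count4 f a b
window-cross-dead f a b row col
  rewrite window-cells count4 f a b
        | row (b - 1ℤ) | row (b + 1ℤ) | col (a - 1ℤ) | col (a + 1ℤ) | row b
  = cong₄ count4 (xor-identityʳ (f (a - 1ℤ) (b - 1ℤ))) (xor-identityʳ (f (a - 1ℤ) (b + 1ℤ)))
                 (xor-identityʳ (f (a + 1ℤ) (b - 1ℤ))) refl

-- At odd time 2m+1 an even cell sees the window of c m around (a , b); by the
-- sublattice structure of c m only the corners can be live, and then they are the
-- diagonal neighbours of (a , b) at time m.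
no-three-odd : ∀ m → NoThree m → ∀ a b → sumX (c (suc (m ℕ.+ m))) (dbl a) (dbl b) ≢ 3
no-three-odd m ih a b e = window-not-three (trans (sym (diag-at-even m (proj₂ (doubling m)) count4 a b)) e)
  where
  window-not-three : window count4 (c m) a b ≢ 3
  window-not-three with par a Bool.≟ parℕ m | par b Bool.≟ parℕ m
  ... | yes pa | _ = window-rows-dead (c m) a b (row (a - 1ℤ) (par-pred-flip a pa)) (row (a + 1ℤ) (par-succ-flip a pa))
    where
    row : ∀ x → par x ≡ not (parℕ m) → ∀ y → c m x y ≡ false
    row x h y = c-off-lattice m x y (inj₁ h)
  ... | no _ | yes pb = window-cols-dead (c m) a b (col (b - 1ℤ) (par-pred-flip b pb)) (col (b + 1ℤ) (par-succ-flip b pb))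
    where
    col : ∀ y → par y ≡ not (parℕ m) → ∀ x → c m x y ≡ false
    col y h x = c-off-lattice m x y (inj₂ h)
  ... | no pa | no pb = λ e′ → ih a b (trans (sym (window-cross-dead (c m) a b row col)) e′)
    where
    row : ∀ y → c m a y ≡ false
    row y = c-off-lattice m a y (inj₁ (¬-not pa))
    col : ∀ x → c m x b ≡ false
    col x = c-off-lattice m x b (inj₂ (¬-not pb))

halveℕ : ∀ n → ∃[ m ] (n ≡ m ℕ.+ m ⊎ n ≡ suc (m ℕ.+ m))
halveℕ zero = zero , inj₁ refl
halveℕ (suc n) with halveℕ n
... | m , inj₁ n≡ = m , inj₂ (cong suc n≡)
... | m , inj₂ n≡ = suc m , inj₁ (cong suc (trans n≡ (sym (ℕP.+-suc m m))))

odd-half : ∀ i → par i ≡ true → ∃[ a ] i ≡ dbl a + 1ℤ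
odd-half i odd with halve i
... | a , inj₁ (_ , even) = ⊥-elim (not-¬ even odd)
... | a , inj₂ (i≡ , _)   = a , i≡

even-half : ∀ i → par i ≡ false → ∃[ a ] i ≡ dbl a
even-half i even with halve i
... | a , inj₁ (i≡ , _)  = a , i≡
... | a , inj₂ (_ , odd) = ⊥-elim (not-¬ even odd)

-- Cells with
-- a coordinate of the parity of n see nothing; the others are handled by the doubling
-- laws, by strong induction on n.
no-three : ∀ n → NoThree n
no-three = <-rec NoThree halving-step
  where
  halving-step : ∀ n → (∀ {m} → m < n → NoThree m) → NoThree n
  halving-step n ih i j with par i Bool.≟ parℕ n | par j Bool.≟ parℕ n | halveℕ n
  ... | yes pi | _      | _ = zero-not-three (sumX-off-lattice n i j (inj₁ pi))
  ... | no _   | yes pj | _ = zero-not-three (sumX-off-lattice n i j (inj₂ pj))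
  ... | no pi  | no pj  | m , inj₁ refl
    with odd-half i (trans (¬-not pi) (cong not (parℕ-double m)))
       | odd-half j (trans (¬-not pj) (cong not (parℕ-double m)))
  ...   | a , refl | b , refl = no-three-even m a b
  halving-step n ih i j | no pi | no pj | m , inj₂ refl
    with even-half i (trans (trans (¬-not pi) (not-involutive _)) (parℕ-double m))
       | even-half j (trans (trans (¬-not pj) (not-involutive _)) (parℕ-double m))
  ...   | a , refl | b , refl = no-three-odd m (ih (s≤s (ℕP.m≤m+n m m))) a b

-- R2 is R1 turned by 45 degrees

isZero-sound : ∀ {x} → isZero x ≡ true → x ≡ 0ℤ
isZero-sound {+ zero} _ = refl

sum-plus-difference : ∀ i j → (i + j) + (i - j) ≡ i + i
sum-plus-difference = solve-∀

sum-minus-difference : ∀ i j → (i + j) - (i - j) ≡ j + j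
sum-minus-difference = solve-∀

rotate-seed : ∀ i j → isZero i ∧ isZero j ≡ isZero (i + j) ∧ isZero (i - j)
rotate-seed i j = ⇔→≡ {z = true} (mk⇔ forward backward)
  where
  forward : isZero i ∧ isZero j ≡ true → isZero (i + j) ∧ isZero (i - j) ≡ true
  forward h with isZero-sound {i} (∧-conicalˡ _ _ h) | isZero-sound {j} (∧-conicalʳ _ _ h)
  ... | refl | refl = refl
  backward : isZero (i + j) ∧ isZero (i - j) ≡ true → isZero i ∧ isZero j ≡ true
  backward h = cong₂ _∧_ i-zero j-zero
    where
    s≡0 = isZero-sound {i + j} (∧-conicalˡ _ _ h)
    d≡0 = isZero-sound {i - j} (∧-conicalʳ _ _ h)
    i-zero : isZero i ≡ true
    i-zero = trans (sym (isZero-dbl i))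
                   (cong isZero (trans (sym (sum-plus-difference i j)) (cong₂ _+_ s≡0 d≡0)))
    j-zero : isZero j ≡ true
    j-zero = trans (sym (isZero-dbl j))
                   (cong isZero (trans (sym (sum-minus-difference i j)) (cong₂ _-_ s≡0 d≡0)))

count4-rotate : ∀ w x y z → count4 x y z w ≡ count4 w x y z
count4-rotate w x y z = ℕ-rotate (bit w) (bit x) (bit y) (bit z)
  where
  ℕ-rotate : ∀ a b d e → b ℕ.+ d ℕ.+ e ℕ.+ a ≡ a ℕ.+ b ℕ.+ d ℕ.+ e
  ℕ-rotate = ℕ-solve-∀

sumP-rotated : ∀ (f g : Config) → (∀ i j → g i j ≡ f (i + j) (i - j)) →
               ∀ i j → sumP g i j ≡ sumX f (i + j) (i - j)
sumP-rotated f g rotated i j =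
  trans (cong₄ count4 (at i (j - 1ℤ) (e₁ i j) (e₂ i j)) (at i (j + 1ℤ) (e₃ i j) (e₄ i j))
                      (at (i + 1ℤ) j (e₅ i j) (e₆ i j)) (at (i - 1ℤ) j (e₇ i j) (e₈ i j)))
        (count4-rotate (f (P - 1ℤ) (Q - 1ℤ)) (f (P - 1ℤ) (Q + 1ℤ)) (f (P + 1ℤ) (Q - 1ℤ)) (f (P + 1ℤ) (Q + 1ℤ)))
  where
  P = i + j
  Q = i - j
  at : ∀ x y {p q} → x + y ≡ p → x - y ≡ q → g x y ≡ f p q
  at x y s d = trans (rotated x y) (cong₂ f s d)
  e₁ : ∀ i j → i + (j - 1ℤ) ≡ (i + j) - 1ℤ
  e₁ = solve-∀
  e₂ : ∀ i j → i - (j - 1ℤ) ≡ (i - j) + 1ℤ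
  e₂ = solve-∀
  e₃ : ∀ i j → i + (j + 1ℤ) ≡ (i + j) + 1ℤ
  e₃ = solve-∀
  e₄ : ∀ i j → i - (j + 1ℤ) ≡ (i - j) - 1ℤ
  e₄ = solve-∀
  e₅ : ∀ i j → (i + 1ℤ) + j ≡ (i + j) + 1ℤ
  e₅ = solve-∀
  e₆ : ∀ i j → (i + 1ℤ) - j ≡ (i - j) + 1ℤ
  e₆ = solve-∀
  e₇ : ∀ i j → (i - 1ℤ) + j ≡ (i + j) - 1ℤ
  e₇ = solve-∀
  e₈ : ∀ i j → (i - 1ℤ) - j ≡ (i - j) - 1ℤ
  e₈ = solve-∀

c₂ : ℕ → Config
c₂ n = firsts (conf C2 n)

rotation : ∀ n i j → conf C2 n i j ≡ conf C1 n (i + j) (i - j)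
rotation zero i j = cong (_, false) (rotate-seed i j)
rotation (suc n) i j =
  cong₂ _,_ (cong₂ _xor_ (cong (λ s → (s ℕ.% 2) ℕ.≡ᵇ 1) counts-match) (cong proj₂ (rotation n i j)))
            (cong proj₁ (rotation n i j))
  where
  counts-match : sumP (c₂ n) i j ≡ sumX (c n) (i + j) (i - j)
  counts-match = sumP-rotated (c n) (c₂ n) (λ x y → cong proj₁ (rotation n x y)) i j

sumP-c₂ : ∀ n i j → sumP (c₂ n) i j ≡ sumX (c n) (i + j) (i - j)
sumP-c₂ n = sumP-rotated (c n) (c₂ n) (λ i j → cong proj₁ (rotation n i j))

-- R3 and R3' have the same orbit as R2

sumX-cong : ∀ {f g : Config} → (∀ i j → f i j ≡ g i j) → ∀ i j → sumX f i j ≡ sumX g i j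
sumX-cong e i j = cong₄ count4 (e (i - 1ℤ) (j - 1ℤ)) (e (i - 1ℤ) (j + 1ℤ)) (e (i + 1ℤ) (j - 1ℤ)) (e (i + 1ℤ) (j + 1ℤ))

sumP-cong : ∀ {f g : Config} → (∀ i j → f i j ≡ g i j) → ∀ i j → sumP f i j ≡ sumP g i j
sumP-cong e i j = cong₄ count4 (e i (j - 1ℤ)) (e i (j + 1ℤ)) (e (i + 1ℤ) j) (e (i - 1ℤ) j)

apply-cong : ∀ r {f g : Config} → (∀ i j → f i j ≡ g i j) → ∀ i j → apply r f i j ≡ apply r g i j
apply-cong C1  e i j = cong (λ s → (s ℕ.% 2) ℕ.≡ᵇ 1) (sumX-cong e i j)
apply-cong C2  e i j = cong (λ s → (s ℕ.% 2) ℕ.≡ᵇ 1) (sumP-cong e i j)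
apply-cong C3  e i j = cong (ℕ._≡ᵇ 1) (sumP-cong e i j)
apply-cong C3' e i j = cong₂ (λ s x → (s ℕ.≡ᵇ 1) ∧ (x ℕ.≡ᵇ 0)) (sumP-cong e i j) (sumX-cong e i j)

same-orbit : ∀ r r' → (∀ n i j → apply r (firsts (conf r' n)) i j ≡ apply r' (firsts (conf r' n)) i j) →
             ∀ n i j → conf r n i j ≡ conf r' n i j
same-orbit r r' agree zero    i j = refl
same-orbit r r' agree (suc n) i j =
  cong₂ _,_ (cong₂ _xor_ (trans (apply-cong r (λ x y → cong proj₁ (ih x y)) i j) (agree n i j)) (cong proj₂ (ih i j)))
            (cong proj₁ (ih i j))
  where
  ih = same-orbit r r' agree n

-- On R2's configurations the orthogonal count is never 3, so "= 1" and "odd" agree.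
C3-agrees-with-C2 : ∀ n i j → apply C3 (c₂ n) i j ≡ apply C2 (c₂ n) i j
C3-agrees-with-C2 n i j =
  one-iff-odd (count4-≤4 (c₂ n i (j - 1ℤ)) (c₂ n i (j + 1ℤ)) (c₂ n (i + 1ℤ) j) (c₂ n (i - 1ℤ) j))
    (λ e → no-three n (i + j) (i - j) (trans (sym (sumP-c₂ n i j)) e))

c₂-off-lattice : ∀ n i j → par (i + j) ≡ not (parℕ n) → c₂ n i j ≡ false
c₂-off-lattice n i j off = ¬-not live⇒on
  where
  live⇒on : c₂ n i j ≢ true
  live⇒on h = not-¬ (proj₁ (c-lattice n (i + j) (i - j) (trans (sym (cong proj₁ (rotation n i j))) h))) off

-- For R2, every cell has all orthogonal or all diagonal neighbours dead: the diagonal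
-- neighbours of (i , j) have coordinate sums of the parity of i + j, the orthogonal
-- ones of the other parity.
orthogonal-or-diagonal-dead : ∀ n i j → sumP (c₂ n) i j ≡ 0 ⊎ sumX (c₂ n) i j ≡ 0
orthogonal-or-diagonal-dead n i j with par (i + j) Bool.≟ parℕ n
... | yes on  = inj₁ (trans (sumP-c₂ n i j) (sumX-off-lattice n (i + j) (i - j) (inj₁ on)))
... | no off = inj₂ (cong₄ count4
        (dead (i - 1ℤ) (j - 1ℤ) (trans (cong par (e₁ i j)) (twice-flipped (par--1 (i + j - 1ℤ)) (par--1 (i + j)))))
        (dead (i - 1ℤ) (j + 1ℤ) (cong par (e₂ i j)))
        (dead (i + 1ℤ) (j - 1ℤ) (cong par (e₃ i j)))
        (dead (i + 1ℤ) (j + 1ℤ) (trans (cong par (e₄ i j)) (twice-flipped (par-+1 (i + j + 1ℤ)) (par-+1 (i + j))))))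
  where
  dead : ∀ x y → par (x + y) ≡ par (i + j) → c₂ n x y ≡ false
  dead x y same = c₂-off-lattice n x y (trans same (¬-not off))
  twice-flipped : ∀ {a b d} → a ≡ not b → b ≡ not d → a ≡ d
  twice-flipped a≡ b≡ = trans a≡ (trans (cong not b≡) (not-involutive _))
  e₁ : ∀ i j → (i - 1ℤ) + (j - 1ℤ) ≡ ((i + j) - 1ℤ) - 1ℤ
  e₁ = solve-∀
  e₂ : ∀ i j → (i - 1ℤ) + (j + 1ℤ) ≡ i + j
  e₂ = solve-∀
  e₃ : ∀ i j → (i + 1ℤ) + (j - 1ℤ) ≡ i + j
  e₃ = solve-∀
  e₄ : ∀ i j → (i + 1ℤ) + (j + 1ℤ) ≡ ((i + j) + 1ℤ) + 1ℤ
  e₄ = solve-∀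

one-and-zero : ∀ s x → s ≡ 0 ⊎ x ≡ 0 → (s ℕ.≡ᵇ 1) ∧ (x ℕ.≡ᵇ 0) ≡ (s ℕ.≡ᵇ 1)
one-and-zero .0 x (inj₁ refl) = refl
one-and-zero s .0 (inj₂ refl) = ∧-identityʳ _

C3'-agrees-with-C3 : ∀ n i j → apply C3' (c₂ n) i j ≡ apply C3 (c₂ n) i j
C3'-agrees-with-C3 n i j = one-and-zero _ _ (orthogonal-or-diagonal-dead n i j)

R3-is-R2 : ∀ n i j → conf C3 n i j ≡ conf C2 n i j
R3-is-R2 = same-orbit C3 C2 C3-agrees-with-C2

R3'-is-R2 : ∀ n i j → conf C3' n i j ≡ conf C2 n i j
R3'-is-R2 = same-orbit C3' C2 (λ n i j → trans (C3'-agrees-with-C3 n i j) (C3-agrees-with-C2 n i j))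

no-11 : ∀ r n i j → conf r n i j ≢ (true , true)
no-11 C1  n i j   = R1-no-11 n i j
no-11 C2  n i j h = R1-no-11 n (i + j) (i - j) (trans (sym (rotation n i j)) h)
no-11 C3  n i j h = no-11 C2 n i j (trans (sym (R3-is-R2 n i j)) h)
no-11 C3' n i j h = no-11 C2 n i j (trans (sym (R3'-is-R2 n i j)) h)

-- Light cone: C_n vanishes outside the square [-n , n]²

Beyond : ℕ → ℤ → ℤ → Set
Beyond n x y = n < ∣ x ∣ ⊎ n < ∣ y ∣

record Shift (s : ℤ → ℤ) : Set where
  field
    at-most-one : ∀ {n} x → suc n < ∣ x ∣ → n < ∣ s x ∣

shift-stay : Shift (λ x → x)
shift-stay .Shift.at-most-one x far = ℕP.<-trans (ℕP.n<1+n _) far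

shift-pred : Shift (_- 1ℤ)
shift-pred .Shift.at-most-one x far = ℕP.≤-pred (ℕP.≤-trans far (∣x∣≤1+∣x-1∣ x))
  where
  ∣x∣≤1+∣x-1∣ : ∀ x → ∣ x ∣ ≤ suc ∣ x - 1ℤ ∣
  ∣x∣≤1+∣x-1∣ (+ zero)  = z≤n
  ∣x∣≤1+∣x-1∣ (+ suc k) = ℕP.≤-refl
  ∣x∣≤1+∣x-1∣ -[1+ k ]  rewrite ℕP.+-identityʳ k = ℕP.≤-trans (ℕP.n≤1+n _) (ℕP.n≤1+n _)

shift-succ : Shift (_+ 1ℤ)
shift-succ .Shift.at-most-one x far = ℕP.≤-pred (ℕP.≤-trans far (∣x∣≤1+∣x+1∣ x))
  where
  ∣x∣≤1+∣x+1∣ : ∀ x → ∣ x ∣ ≤ suc ∣ x + 1ℤ ∣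
  ∣x∣≤1+∣x+1∣ (+ k)          = ℕP.≤-trans (ℕP.m≤m+n k 1) (ℕP.n≤1+n _)
  ∣x∣≤1+∣x+1∣ -[1+ zero ]    = ℕP.≤-refl
  ∣x∣≤1+∣x+1∣ -[1+ suc k ]   = ℕP.≤-refl

beyond-shift : ∀ {s t n} → Shift s → Shift t → ∀ x y → Beyond (suc n) x y → Beyond n (s x) (t y)
beyond-shift ss st x y = Sum.map (Shift.at-most-one ss x) (Shift.at-most-one st y)

Vanishes : ℕ → Config → Set
Vanishes n f = ∀ x y → Beyond n x y → f x y ≡ false

apply-quiet : ∀ r f x y → sumX f x y ≡ 0 → sumP f x y ≡ 0 → apply r f x y ≡ false
apply-quiet C1  f x y sx sp = cong (λ s → (s ℕ.% 2) ℕ.≡ᵇ 1) sx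
apply-quiet C2  f x y sx sp = cong (λ s → (s ℕ.% 2) ℕ.≡ᵇ 1) sp
apply-quiet C3  f x y sx sp = cong (ℕ._≡ᵇ 1) sp
apply-quiet C3' f x y sx sp = cong₂ (λ s t → (s ℕ.≡ᵇ 1) ∧ (t ℕ.≡ᵇ 0)) sp sx

apply-vanishes : ∀ r n f → Vanishes n f → Vanishes (suc n) (apply r f)
apply-vanishes r n f v x y far = apply-quiet r f x y
  (cong₄ count4 (v (x - 1ℤ) (y - 1ℤ) (beyond-shift shift-pred shift-pred x y far))
                (v (x - 1ℤ) (y + 1ℤ) (beyond-shift shift-pred shift-succ x y far))
                (v (x + 1ℤ) (y - 1ℤ) (beyond-shift shift-succ shift-pred x y far))
                (v (x + 1ℤ) (y + 1ℤ) (beyond-shift shift-succ shift-succ x y far)))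
  (cong₄ count4 (v x (y - 1ℤ) (beyond-shift shift-stay shift-pred x y far))
                (v x (y + 1ℤ) (beyond-shift shift-stay shift-succ x y far))
                (v (x + 1ℤ) y (beyond-shift shift-succ shift-stay x y far))
                (v (x - 1ℤ) y (beyond-shift shift-pred shift-stay x y far)))

isZero-far : ∀ {x} → 0 < ∣ x ∣ → isZero x ≡ false
isZero-far {+ suc _}  _ = refl
isZero-far { -[1+ _ ]} _ = refl

light-cone : ∀ r n x y → Beyond n x y → conf r n x y ≡ (false , false)
light-cone r zero x y (inj₁ far) rewrite isZero-far {x} far = refl
light-cone r zero x y (inj₂ far) rewrite isZero-far {y} far = cong (_, false) (∧-zeroʳ (isZero x))
light-cone r (suc n) x y far =
  cong₂ _,_ (cong₂ _xor_ (apply-vanishes r n (firsts (conf r n)) first-vanishes x y far) (cong proj₂ before))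
            (cong proj₁ before)
  where
  before = light-cone r n x y (beyond-shift shift-stay shift-stay x y far)
  first-vanishes : Vanishes n (firsts (conf r n))
  first-vanishes x' y' far' = cong proj₁ (light-cone r n x' y' far')

in-square : ∀ r n x y → conf r n x y ≢ (false , false) → ∣ x ∣ ≤ n × ∣ y ∣ ≤ n
in-square r n x y nonempty with ∣ x ∣ ℕ.≤? n | ∣ y ∣ ℕ.≤? n
... | yes x≤n | yes y≤n = x≤n , y≤n
... | no x≰n  | _       = ⊥-elim (nonempty (light-cone r n x y (inj₁ (ℕP.≰⇒> x≰n))))
... | yes _   | no y≰n  = ⊥-elim (nonempty (light-cone r n x y (inj₂ (ℕP.≰⇒> y≰n))))

box : ℕ → List (ℤ × ℤ)
box N = cartesianProduct (range N) (range N)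

selected : (Bool × Bool → Bool) → Config2 → ℤ × ℤ → Bool
selected P s = P ∘ uncurry s

rows-as-product : ∀ {B : Set} (g : ℤ → ℤ → B) xs ys →
  concatMap (λ i → map (g i) ys) xs ≡ map (uncurry g) (cartesianProduct xs ys)
rows-as-product g []       ys = refl
rows-as-product g (x ∷ xs) ys = begin
  map (g x) ys ++ concatMap (λ i → map (g i) ys) xs
    ≡⟨ cong₂ _++_ (map-∘ ys) (rows-as-product g xs ys) ⟩
  map (uncurry g) (map (x ,_) ys) ++ map (uncurry g) (cartesianProduct xs ys)
    ≡⟨ map-++ (uncurry g) (map (x ,_) ys) _ ⟨
  map (uncurry g) (map (x ,_) ys ++ cartesianProduct xs ys) ∎

sum-bits : ∀ {A : Set} (h : A → Bool) xs → sum (map (bit ∘ h) xs) ≡ length (filterᵇ h xs)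
sum-bits h [] = refl
sum-bits h (x ∷ xs) with h x
... | true  = cong suc (sum-bits h xs)
... | false = sum-bits h xs

countBox-as-length : ∀ N P s → countBox N P s ≡ length (filterᵇ (selected P s) (box N))
countBox-as-length N P s =
  trans (cong sum (rows-as-product (λ i j → bit (P (s i j))) (range N) (range N)))
        (sum-bits (selected P s) (box N))

countBox-cong : ∀ N P (s t : Config2) → (∀ i j → s i j ≡ t i j) → countBox N P s ≡ countBox N P t
countBox-cong N P s t s≗t =
  cong sum (concatMap-cong (λ i → map-cong (λ j → cong (bit ∘ P) (s≗t i j)) (range N)) (range N))

∈-range : ∀ N i → ∣ i ∣ ≤ N → i ∈ range N
∈-range N (+ a) a≤N =
  subst (_∈ range N) (trans (cong (_- + N) (ℤP.pos-+ a N)) (cancel (+ a) (+ N)))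
    (∈-map⁺ (λ k → + k - + N) (∈-upTo⁺ (s≤s (ℕP.+-monoˡ-≤ N a≤N))))
  where
  cancel : ∀ x y → (x + y) - y ≡ x
  cancel = solve-∀
∈-range N -[1+ a ] a<N =
  subst (_∈ range N) (trans (cong (_- + N) (trans (sym (ℤP.⊖-≥ a<N)) (sym (ℤP.m-n≡m⊖n N (suc a)))))
                            (cancel (+ N) (+ suc a)))
    (∈-map⁺ (λ k → + k - + N) (∈-upTo⁺ (s≤s (ℕP.≤-trans (ℕP.m∸n≤m N (suc a)) (ℕP.m≤m+n N N)))))
  where
  cancel : ∀ x y → (x - y) - x ≡ - y
  cancel = solve-∀

range-unique : ∀ N → Unique (range N)
range-unique N = Unique.map⁺ shift-injective (Unique.upTo⁺ _)
  where
  cancel : ∀ x y → (x - y) + y ≡ x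
  cancel = solve-∀
  shift-injective : ∀ {k k'} → + k - + N ≡ + k' - + N → k ≡ k'
  shift-injective {k} {k'} e =
    ℤP.+-injective (trans (sym (cancel (+ k) (+ N))) (trans (cong (_+ + N) e) (cancel (+ k') (+ N))))

box-unique : ∀ N → Unique (box N)
box-unique N = Unique.cartesianProduct⁺ (range-unique N) (range-unique N)

selected-in-box : ∀ P → P (false , false) ≡ false → ∀ r n N → n ≤ N →
                  ∀ z → T (selected P (conf r n) z) → z ∈ filterᵇ (selected P (conf r n)) (box N)
selected-in-box P quiet r n N n≤N (x , y) sel =
  ∈-filter⁺ (T? ∘ selected P (conf r n))
    (∈-cartesianProduct⁺ (∈-range N x (ℕP.≤-trans x≤n n≤N)) (∈-range N y (ℕP.≤-trans y≤n n≤N)))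
    sel
  where
  nonempty : conf r n x y ≢ (false , false)
  nonempty empty = subst T (trans (cong P empty) quiet) sel
  x≤n = proj₁ (in-square r n x y nonempty)
  y≤n = proj₂ (in-square r n x y nonempty)

same-members-same-length : ∀ {A : Set} {xs ys : List A} → Unique xs → Unique ys →
                           (∀ {z} → z ∈ xs ⇔ z ∈ ys) → length xs ≡ length ys
same-members-same-length u v same = ↭-length (∼bag⇒↭ (unique∧set⇒bag u v same))

-- Counting R2 against R1

rotate : ℤ × ℤ → ℤ × ℤ
rotate (i , j) = i + j , i - j

double-injective : ∀ {i k} → i + i ≡ k + k → i ≡ k
double-injective {i} {k} e =
  ℤP.*-cancelˡ-≡ (+ 2) i k (trans (two-times i) (trans e (sym (two-times k))))
  where
  two-times : ∀ i → + 2 * i ≡ i + i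
  two-times = solve-∀

rotate-injective : ∀ {z z'} → rotate z ≡ rotate z' → z ≡ z'
rotate-injective {i , j} {k , l} e =
  cong₂ _,_ (double-injective (trans (sym (sum-plus-difference i j)) (trans (cong₂ _+_ e₁ e₂) (sum-plus-difference k l))))
            (double-injective (trans (sym (sum-minus-difference i j)) (trans (cong₂ _-_ e₁ e₂) (sum-minus-difference k l))))
  where
  e₁ = cong proj₁ e
  e₂ = cong proj₂ e

rotate-onto : ∀ p q → par p ≡ par q → ∃[ z ] rotate z ≡ (p , q)
rotate-onto p q same with halve p | halve q
... | a , inj₁ (p≡ , _) | b , inj₁ (q≡ , _) =
  (a + b , a - b) , cong₂ _,_ (trans (even₁ a b) (sym p≡)) (trans (even₂ a b) (sym q≡))
  where
  even₁ : ∀ a b → (a + b) + (a - b) ≡ a + a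
  even₁ = solve-∀
  even₂ : ∀ a b → (a + b) - (a - b) ≡ b + b
  even₂ = solve-∀
... | a , inj₂ (p≡ , _) | b , inj₂ (q≡ , _) =
  (a + b + 1ℤ , a - b) , cong₂ _,_ (trans (odd₁ a b) (sym p≡)) (trans (odd₂ a b) (sym q≡))
  where
  odd₁ : ∀ a b → (a + b + 1ℤ) + (a - b) ≡ a + a + 1ℤ
  odd₁ = solve-∀
  odd₂ : ∀ a b → (a + b + 1ℤ) - (a - b) ≡ b + b + 1ℤ
  odd₂ = solve-∀
... | _ , inj₁ (_ , even) | _ , inj₂ (_ , odd) = ⊥-elim (not-¬ (trans (sym same) even) odd)
... | _ , inj₂ (_ , odd) | _ , inj₁ (_ , even) = ⊥-elim (not-¬ (trans same even) odd)

nonempty-layers : ∀ {v : Bool × Bool} → v ≢ (false , false) → proj₁ v ≡ true ⊎ proj₂ v ≡ true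
nonempty-layers {true  , _}     _        = inj₁ refl
nonempty-layers {false , true}  _        = inj₂ refl
nonempty-layers {false , false} nonempty = ⊥-elim (nonempty refl)

countBox-rotation : ∀ P → P (false , false) ≡ false → ∀ n N → n ≤ N →
                    countBox N P (conf C2 n) ≡ countBox N P (conf C1 n)
countBox-rotation P quiet n N n≤N = begin
  countBox N P (conf C2 n)  ≡⟨ countBox-as-length N P (conf C2 n) ⟩
  length L₂                 ≡⟨ length-map rotate L₂ ⟨
  length (map rotate L₂)    ≡⟨ same-members-same-length unique₂ unique₁ (mk⇔ to from) ⟩
  length L₁                 ≡⟨ countBox-as-length N P (conf C1 n) ⟨
  countBox N P (conf C1 n)  ∎
  where
  sel₁ = selected P (conf C1 n)
  sel₂ = selected P (conf C2 n)
  L₁ = filterᵇ sel₁ (box N)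
  L₂ = filterᵇ sel₂ (box N)
  unique₁ : Unique L₁
  unique₁ = Unique.filter⁺ (T? ∘ sel₁) (box-unique N)
  unique₂ : Unique (map rotate L₂)
  unique₂ = Unique.map⁺ rotate-injective (Unique.filter⁺ (T? ∘ sel₂) (box-unique N))
  sel-rotate : ∀ z → sel₂ z ≡ sel₁ (rotate z)
  sel-rotate (i , j) = cong P (rotation n i j)
  to : ∀ {y} → y ∈ map rotate L₂ → y ∈ L₁
  to y∈ with ∈-map⁻ rotate y∈
  ... | z , z∈ , refl = selected-in-box P quiet C1 n N n≤N (rotate z)
          (subst T (sel-rotate z) (proj₂ (∈-filter⁻ (T? ∘ sel₂) {xs = box N} z∈)))
  from : ∀ {y} → y ∈ L₁ → y ∈ map rotate L₂
  from {p , q} y∈ = selected-preimage (rotate-onto p q (R1-checkerboard n p q (nonempty-layers nonempty)))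
    where
    sel : T (sel₁ (p , q))
    sel = proj₂ (∈-filter⁻ (T? ∘ sel₁) {xs = box N} y∈)
    nonempty : conf C1 n p q ≢ (false , false)
    nonempty empty = subst T (trans (cong P empty) quiet) sel
    selected-preimage : ∃[ z ] rotate z ≡ (p , q) → (p , q) ∈ map rotate L₂
    selected-preimage (z , z↦pq) =
      subst (_∈ map rotate L₂) z↦pq
        (∈-map⁺ rotate (selected-in-box P quiet C2 n N n≤N z
          (subst T (sym (trans (sel-rotate z) (cong sel₁ z↦pq))) sel)))

count-as-R1 : ∀ P → P (false , false) ≡ false → ∀ r n N → n ≤ N →
              countBox N P (conf r n) ≡ countBox N P (conf C1 n)
count-as-R1 P quiet C1  n N n≤N = refl
count-as-R1 P quiet C2  n N n≤N = countBox-rotation P quiet n N n≤N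
count-as-R1 P quiet C3  n N n≤N =
  trans (countBox-cong N P (conf C3 n) (conf C2 n) (R3-is-R2 n)) (countBox-rotation P quiet n N n≤N)
count-as-R1 P quiet C3' n N n≤N =
  trans (countBox-cong N P (conf C3' n) (conf C2 n) (R3'-is-R2 n)) (countBox-rotation P quiet n N n≤N)

mainTheorem1 : ((r : Rule) (n : ℕ) (i j : ℤ) → conf r n i j ≢ (true , true))
    × ((r r' : Rule) (n N : ℕ) → n ≤ N →
         (Rbox N r n ≡ Rbox N r' n)
         × (Rkbox 1 N r n ≡ Rkbox 1 N r' n)
         × (Rkbox 2 N r n ≡ Rkbox 2 N r' n))
mainTheorem1 = no-11 , counts-agree
  where
  counts-agree : (r r' : Rule) (n N : ℕ) → n ≤ N →
                 (Rbox N r n ≡ Rbox N r' n) × (Rkbox 1 N r n ≡ Rkbox 1 N r' n) × (Rkbox 2 N r n ≡ Rkbox 2 N r' n)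
  counts-agree r r' n N n≤N = same nonzeroV refl , same (valueIs 1) refl , same (valueIs 2) refl
    where
    same : ∀ P → P (false , false) ≡ false → countBox N P (conf r n) ≡ countBox N P (conf r' n)
    same P quiet = trans (count-as-R1 P quiet r n N n≤N) (sym (count-as-R1 P quiet r' n N n≤N))
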